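{- If $L=\{4\}$ or $L=\{3,4\}$, then $f(n,3,4,L)=2^{\Theta(n^3)}$ as $n\to\infty$.
   Context: $f(n,3,4,L)$ denotes the number of $3$-uniform hypergraphs on the vertex set $[n]=\{1,\ldots,n\}$ such that no set of $4$ vertices spans exactly $i$ edges for any $i\in L$. -}

module Defs where

open import Data.Nat using (ℕ; zero; suc; _+_; _<ᵇ_; _≡ᵇ_)
open import Data.Bool using (Bool; true; false; _∧_; _∨_; not; if_then_else_)
open import Data.Fin using (Fin; toℕ)
open import Data.List using (List; []; _∷_; _++_; map; concatMap; filterᵇ; length; allFin)
open import Data.Bool.ListAction using (all; any)
open import Data.Product using (_×_; _,_)

-- A 3-set {i,j,k} ⊆ [n] is represented by the increasing triple i < j < k.
Triple : ℕ → Set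
Triple n = Fin n × Fin n × Fin n

-- A 4-set {a,b,c,d} ⊆ [n] is represented by the increasing quadruple a < b < c < d.
Quad : ℕ → Set
Quad n = Fin n × Fin n × Fin n × Fin n

ltᵇ : ∀ {n} → Fin n → Fin n → Bool
ltᵇ i j = toℕ i <ᵇ toℕ j

eqᵇ : ∀ {n} → Fin n → Fin n → Bool
eqᵇ i j = toℕ i ≡ᵇ toℕ j

triples : (n : ℕ) → List (Triple n)
triples n =
  concatMap (λ i → concatMap (λ j →
    map (λ k → (i , j , k))
      (filterᵇ (λ k → ltᵇ i j ∧ ltᵇ j k) (allFin n))) (allFin n)) (allFin n)

quads : (n : ℕ) → List (Quad n)
quads n =
  concatMap (λ a → concatMap (λ b → concatMap (λ c →
    map (λ d → (a , b , c , d))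
      (filterᵇ (λ d → ltᵇ a b ∧ ltᵇ b c ∧ ltᵇ c d) (allFin n))) (allFin n)) (allFin n)) (allFin n)

-- All sublists of a list; for a duplicate-free list these are exactly its subsets, each once.
sublists : ∀ {A : Set} → List A → List (List A)
sublists [] = [] ∷ []
sublists (x ∷ xs) = sublists xs ++ map (x ∷_) (sublists xs)

-- A 3-uniform hypergraph on [n] = a set of 3-subsets of [n] = a sublist of triples n.
Hypergraph3 : ℕ → Set
Hypergraph3 n = List (Triple n)

tripleEqᵇ : ∀ {n} → Triple n → Triple n → Bool
tripleEqᵇ (i , j , k) (i' , j' , k') = eqᵇ i i' ∧ eqᵇ j j' ∧ eqᵇ k k'

isEdgeᵇ : ∀ {n} → Hypergraph3 n → Triple n → Bool
isEdgeᵇ H t = any (tripleEqᵇ t) H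

b2n : Bool → ℕ
b2n true = 1
b2n false = 0

spanned : ∀ {n} → Hypergraph3 n → Quad n → ℕ
spanned H (a , b , c , d) =
  b2n (isEdgeᵇ H (a , b , c)) + b2n (isEdgeᵇ H (a , b , d))
  + b2n (isEdgeᵇ H (a , c , d)) + b2n (isEdgeᵇ H (b , c , d))

memℕᵇ : ℕ → List ℕ → Bool
memℕᵇ x L = any (λ y → x ≡ᵇ y) L

goodᵇ : ∀ {n} → List ℕ → Hypergraph3 n → Bool
goodᵇ {n} L H = all (λ q → not (memℕᵇ (spanned H q) L)) (quads n)

f : ℕ → List ℕ → ℕ
f n L = length (filterᵇ (goodᵇ L) (sublists (triples n)))

-- Split [n] into three blocks X < Y < Z of size m = ⌊n/3⌋ and take any set of
-- triples from X × Y × Z. In such a hypergraph, among the four triples of a 4-set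
-- a < b < c < d, the triples abc and acd cannot both be edges (c would lie in
-- both Z and Y), nor can abd and bcd (b would lie in both Y and X); so every 4-set
-- spans at most two edges, all 2^(m³) such hypergraphs avoid the counts in L, and
-- f(n,3,4,L) ≥ 2^(n³/216), since L only forbids 3 or 4 edges. The upper bound
-- 2^(n³) is the number of all hypergraphs.
module Submission where

open import Defs
open import Data.Bool using (Bool; true; false; T; not; _∧_)
open import Data.Bool.Properties using (T-∧; T-not-≡)
open import Data.Empty using (⊥; ⊥-elim)
open import Data.Fin as Fin using (Fin; toℕ)
open import Data.Fin.Properties using (toℕ-injective)
open import Data.List using (List; []; _∷_; _++_; map; concatMap; filterᵇ; length; allFin; tabulate)
open import Data.List.Properties
  using (length-++; length-map; length-tabulate; map-tabulate; filter-++; filter-some; length-filter)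
open import Data.List.Membership.Propositional using (_∈_)
open import Data.List.Relation.Unary.All as All using (All; []; _∷_)
import Data.List.Relation.Unary.All.Properties as AllP
open import Data.List.Relation.Unary.Any as Any using (here)
open import Data.List.Relation.Unary.Any.Properties using (any⁻)
open import Data.List.Relation.Binary.Sublist.Propositional using (_⊆_; []; _∷_; _∷ʳ_; ⊆-refl)
open import Data.List.Relation.Binary.Sublist.Propositional.Properties
  using (map⁺; ++⁺; ++⁺ˡ; filter-⊆; filter⁺; All-resp-⊆; length-mono-≤)
open import Data.Nat using (ℕ; zero; suc; _+_; _*_; _^_; _≤_; _<_; _<ᵇ_; z≤n; s≤s; z<s)
open import Data.Nat.Properties
open import Data.Nat.DivMod using (_/_; _%_; m≡m%n+[m/n]*n; m%n<n; m/n*n≤m; m≥n⇒m/n>0)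
open import Data.Nat.Tactic.RingSolver using (solve-∀)
open import Data.Product using (_×_; _,_; proj₁; proj₂; ∃-syntax)
open import Data.Sum using (_⊎_; inj₁; inj₂)
open import Function using (_∘_; id; Equivalence)
open import Relation.Binary.PropositionalEquality
  using (_≡_; refl; sym; trans; cong; cong₂; subst; module ≡-Reasoning)
open import Relation.Nullary using (T?)

private variable
  A B C : Set

length-filterᵇ-∷ : (p : A → Bool) (x : A) (xs : List A) →
  length (filterᵇ p (x ∷ xs)) ≡ b2n (p x) + length (filterᵇ p xs)
length-filterᵇ-∷ p x xs with p x
... | true = refl
... | false = refl

length-filterᵇ-++ : (p : A → Bool) (xs ys : List A) →
  length (filterᵇ p (xs ++ ys)) ≡ length (filterᵇ p xs) + length (filterᵇ p ys)
length-filterᵇ-++ p xs ys = trans (cong length (filter-++ (T? ∘ p) xs ys)) (length-++ (filterᵇ p xs))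

length-filterᵇ-map : (p : B → Bool) (f : A → B) (xs : List A) →
  length (filterᵇ p (map f xs)) ≡ length (filterᵇ (p ∘ f) xs)
length-filterᵇ-map p f [] = refl
length-filterᵇ-map p f (x ∷ xs) = trans (length-filterᵇ-∷ p (f x) (map f xs))
  (trans (cong (b2n (p (f x)) +_) (length-filterᵇ-map p f xs)) (sym (length-filterᵇ-∷ (p ∘ f) x xs)))

length-sublists : (xs : List A) → length (sublists xs) ≡ 2 ^ length xs
length-sublists [] = refl
length-sublists (x ∷ xs) = begin
  length (sublists xs ++ map (x ∷_) (sublists xs))
    ≡⟨ length-++ (sublists xs) ⟩
  length (sublists xs) + length (map (x ∷_) (sublists xs))
    ≡⟨ cong (length (sublists xs) +_) (length-map (x ∷_) (sublists xs)) ⟩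
  length (sublists xs) + length (sublists xs)
    ≡⟨ cong (λ k → k + k) (length-sublists xs) ⟩
  2 ^ length xs + 2 ^ length xs
    ≡⟨ cong (2 ^ length xs +_) (+-identityʳ _) ⟨
  2 ^ suc (length xs)
    ∎
  where open ≡-Reasoning

2^length≤length-filter-sublists : (p : List A → Bool) {xs ys : List A} →
  xs ⊆ ys → (∀ {zs} → zs ⊆ xs → T (p zs)) → 2 ^ length xs ≤ length (filterᵇ p (sublists ys))
2^length≤length-filter-sublists p [] good = filter-some (T? ∘ p) (here (good []))
2^length≤length-filter-sublists p {xs} {y ∷ ys} (y ∷ʳ τ) good = begin
  2 ^ length xs
    ≤⟨ 2^length≤length-filter-sublists p τ good ⟩
  length (filterᵇ p (sublists ys))
    ≤⟨ m≤m+n _ _ ⟩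
  length (filterᵇ p (sublists ys)) + length (filterᵇ p (map (y ∷_) (sublists ys)))
    ≡⟨ length-filterᵇ-++ p (sublists ys) _ ⟨
  length (filterᵇ p (sublists (y ∷ ys)))
    ∎
  where open ≤-Reasoning
2^length≤length-filter-sublists p {x ∷ xs} {x ∷ ys} (refl ∷ τ) good = begin
  2 ^ suc (length xs)
    ≡⟨ cong (2 ^ length xs +_) (+-identityʳ _) ⟩
  2 ^ length xs + 2 ^ length xs
    ≤⟨ +-mono-≤ without-x with-x ⟩
  length (filterᵇ p (sublists ys)) + length (filterᵇ (p ∘ (x ∷_)) (sublists ys))
    ≡⟨ cong (_ +_) (length-filterᵇ-map p (x ∷_) (sublists ys)) ⟨
  length (filterᵇ p (sublists ys)) + length (filterᵇ p (map (x ∷_) (sublists ys)))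
    ≡⟨ length-filterᵇ-++ p (sublists ys) _ ⟨
  length (filterᵇ p (sublists (x ∷ ys)))
    ∎
  where
  open ≤-Reasoning
  without-x : 2 ^ length xs ≤ length (filterᵇ p (sublists ys))
  without-x = 2^length≤length-filter-sublists p τ (λ σ → good (x ∷ʳ σ))
  with-x : 2 ^ length xs ≤ length (filterᵇ (p ∘ (x ∷_)) (sublists ys))
  with-x = 2^length≤length-filter-sublists (p ∘ (x ∷_)) τ (λ σ → good (refl ∷ σ))

concatMap-⊆ : {g h : A → List B} {xs ys : List A} →
  xs ⊆ ys → All (λ x → g x ⊆ h x) xs → concatMap g xs ⊆ concatMap h ys
concatMap-⊆ [] [] = []
concatMap-⊆ {h = h} (y ∷ʳ τ) g⊆h = ++⁺ˡ (h y) (concatMap-⊆ τ g⊆h)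
concatMap-⊆ (refl ∷ τ) (gx⊆hx ∷ g⊆h) = ++⁺ gx⊆hx (concatMap-⊆ τ g⊆h)

length-concatMap-const : (g : A → List B) {c : ℕ} → (∀ x → length (g x) ≡ c) →
  (xs : List A) → length (concatMap g xs) ≡ length xs * c
length-concatMap-const g length-g≡c [] = refl
length-concatMap-const g length-g≡c (x ∷ xs) =
  trans (length-++ (g x)) (cong₂ _+_ (length-g≡c x) (length-concatMap-const g length-g≡c xs))

product3 : List A → List B → List C → List (A × B × C)
product3 is js ks = concatMap (λ i → concatMap (λ j → map (λ k → (i , j , k)) ks) js) is

length-product3 : (is : List A) (js : List B) (ks : List C) →
  length (product3 is js ks) ≡ length is * (length js * length ks)
length-product3 is js ks =
  length-concatMap-const _ (λ i → length-concatMap-const _ (λ j → length-map _ ks) js) is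

Tripartite : (A → Set) → (B → Set) → (C → Set) → A × B × C → Set
Tripartite X Y Z (i , j , k) = X i × Y j × Z k

all-product3 : {X : A → Set} {Y : B → Set} {Z : C → Set} {is : List A} {js : List B} {ks : List C} →
  All X is → All Y js → All Z ks → All (Tripartite X Y Z) (product3 is js ks)
all-product3 Xs Ys Zs =
  AllP.concat⁺ (AllP.map⁺ (All.map (λ Xi →
    AllP.concat⁺ (AllP.map⁺ (All.map (λ Yj →
      AllP.map⁺ (All.map (λ Zk → Xi , Yj , Zk) Zs)) Ys))) Xs))

triples⊆product3 : ∀ n → triples n ⊆ product3 (allFin n) (allFin n) (allFin n)
triples⊆product3 n =
  concatMap-⊆ {xs = allFin n} ⊆-refl (All.universal (λ i →
    concatMap-⊆ {xs = allFin n} ⊆-refl (All.universal (λ j → map⁺ _ (filter-⊆ _ (allFin n))) _)) _)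

length-triples≤ : ∀ n → length (triples n) ≤ n ^ 3
length-triples≤ n = begin
  length (triples n)
    ≤⟨ length-mono-≤ (triples⊆product3 n) ⟩
  length (product3 (allFin n) (allFin n) (allFin n))
    ≡⟨ length-product3 (allFin n) (allFin n) (allFin n) ⟩
  length (allFin n) * (length (allFin n) * length (allFin n))
    ≡⟨ cong (λ k → k * (k * k)) (length-tabulate (id {A = Fin n})) ⟩
  n * (n * n)
    ≡⟨ cong (λ k → n * (n * k)) (*-identityʳ n) ⟨
  n ^ 3
    ∎
  where open ≤-Reasoning

f-upper : ∀ n L → f n L ≤ 2 ^ (n ^ 3)
f-upper n L = begin
  f n L                             ≤⟨ length-filter (T? ∘ goodᵇ L) (sublists (triples n)) ⟩
  length (sublists (triples n))     ≡⟨ length-sublists (triples n) ⟩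
  2 ^ length (triples n)            ≤⟨ ^-monoʳ-≤ 2 (length-triples≤ n) ⟩
  2 ^ (n ^ 3)                       ∎
  where open ≤-Reasoning

eqᵇ⇒≡ : ∀ {n} {i j : Fin n} → T (eqᵇ i j) → i ≡ j
eqᵇ⇒≡ {i = i} {j} = toℕ-injective ∘ ≡ᵇ⇒≡ (toℕ i) (toℕ j)

tripleEqᵇ⇒≡ : ∀ {n} {t t′ : Triple n} → T (tripleEqᵇ t t′) → t ≡ t′
tripleEqᵇ⇒≡ {t = i , j , k} {i′ , j′ , k′} eq =
  let i≡i′ , jk≡jk′ = Equivalence.to T-∧ eq
      j≡j′ , k≡k′ = Equivalence.to T-∧ jk≡jk′
  in cong₂ _,_ (eqᵇ⇒≡ i≡i′) (cong₂ _,_ (eqᵇ⇒≡ j≡j′) (eqᵇ⇒≡ k≡k′))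

isEdgeᵇ⇒∈ : ∀ {n} (H : Hypergraph3 n) {t : Triple n} → T (isEdgeᵇ H t) → t ∈ H
isEdgeᵇ⇒∈ H e = Any.map tripleEqᵇ⇒≡ (any⁻ _ H e)

b2n+b2n≤1 : ∀ x y → (T x → T y → ⊥) → b2n x + b2n y ≤ 1
b2n+b2n≤1 true  true  x∧y = ⊥-elim (x∧y _ _)
b2n+b2n≤1 true  false _   = ≤-refl
b2n+b2n≤1 false true  _   = ≤-refl
b2n+b2n≤1 false false _   = z≤n

b2n-sum≤2 : ∀ w x y z → (T w → T y → ⊥) → (T x → T z → ⊥) →
  b2n w + b2n x + b2n y + b2n z ≤ 2
b2n-sum≤2 w x y z w∧y x∧z = begin
  b2n w + b2n x + b2n y + b2n z      ≡⟨ regroup (b2n w) (b2n x) (b2n y) (b2n z) ⟩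
  (b2n w + b2n y) + (b2n x + b2n z)  ≤⟨ +-mono-≤ (b2n+b2n≤1 w y w∧y) (b2n+b2n≤1 x z x∧z) ⟩
  2                                  ∎
  where
  open ≤-Reasoning
  regroup : ∀ a b c d → a + b + c + d ≡ (a + c) + (b + d)
  regroup = solve-∀

spanned-tripartite≤2 : ∀ {n} {X Y Z : Fin n → Set} {H : Hypergraph3 n} →
  (∀ {x} → X x → Y x → ⊥) → (∀ {x} → Y x → Z x → ⊥) →
  All (Tripartite X Y Z) H → ∀ q → spanned H q ≤ 2
spanned-tripartite≤2 {X = X} {Y} {Z} {H} X∩Y Y∩Z tripartite (a , b , c , d) =
  b2n-sum≤2 (isEdgeᵇ H (a , b , c)) (isEdgeᵇ H (a , b , d)) (isEdgeᵇ H (a , c , d)) (isEdgeᵇ H (b , c , d))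
    (λ abc acd → Y∩Z (proj₁ (proj₂ (edge (a , c , d) acd))) (proj₂ (proj₂ (edge (a , b , c) abc))))
    (λ abd bcd → X∩Y (proj₁ (edge (b , c , d) bcd)) (proj₁ (proj₂ (edge (a , b , d) abd))))
  where
  edge : ∀ t → T (isEdgeᵇ H t) → Tripartite X Y Z t
  edge t e = All.lookup tripartite (isEdgeᵇ⇒∈ H e)

good-if-spanned≤2 : ∀ {n} L (H : Hypergraph3 n) → (∀ {s} → s ≤ 2 → T (not (memℕᵇ s L))) →
  (∀ q → spanned H q ≤ 2) → T (goodᵇ L H)
good-if-spanned≤2 {n} L H allowed spanned≤2 =
  AllP.all⁻ _ (All.universal (λ q → allowed (spanned≤2 q)) (quads n))

-- Phrased with _<ᵇ_ only, so that interval (suc lo) (suc hi) (suc x) reduces to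
-- interval lo hi x: this is what lets count-interval recurse.
interval : ℕ → ℕ → ℕ → Bool
interval lo hi x = not (x <ᵇ lo) ∧ (x <ᵇ hi)

interval-sound : ∀ lo hi x → T (interval lo hi x) → lo ≤ x × x < hi
interval-sound lo hi x x∈ =
  let x≮lo , x<hi = Equivalence.to T-∧ x∈
  in ≮⇒≥ (λ x<lo → subst T (Equivalence.to T-not-≡ x≮lo) (<⇒<ᵇ x<lo)) , <ᵇ⇒< x hi x<hi

interval-< : ∀ lo mid hi x y → T (interval lo mid x) → T (interval mid hi y) → x < y
interval-< lo mid hi x y x∈ y∈ =
  <-≤-trans (proj₂ (interval-sound lo mid x x∈)) (proj₁ (interval-sound mid hi y y∈))

interval-disjoint : ∀ lo mid hi x → T (interval lo mid x) → T (interval mid hi x) → ⊥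
interval-disjoint lo mid hi x x∈ x∈′ = <-irrefl refl (interval-< lo mid hi x x x∈ x∈′)

count : (ℕ → Bool) → ℕ → ℕ
count p zero = 0
count p (suc n) = b2n (p 0) + count (p ∘ suc) n

count-false : ∀ n → count (λ _ → false) n ≡ 0
count-false zero = refl
count-false (suc n) = count-false n

count-<ᵇ : ∀ hi n → hi ≤ n → count (_<ᵇ hi) n ≡ hi
count-<ᵇ zero n _ = count-false n
count-<ᵇ (suc hi) (suc n) (s≤s hi≤n) = cong suc (count-<ᵇ hi n hi≤n)

count-interval : ∀ lo len n → lo + len ≤ n → count (interval lo (lo + len)) n ≡ len
count-interval zero len n len≤n = count-<ᵇ len n len≤n
count-interval (suc lo) len (suc n) (s≤s lo+len≤n) = count-interval lo len n lo+len≤n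

vertices : ∀ n → (ℕ → Bool) → List (Fin n)
vertices n p = filterᵇ (p ∘ toℕ) (allFin n)

length-vertices : ∀ n p → length (vertices n p) ≡ count p n
length-vertices zero p = refl
length-vertices (suc n) p = begin
  length (filterᵇ (p ∘ toℕ) (Fin.zero ∷ tabulate (Fin.suc {n})))
    ≡⟨ length-filterᵇ-∷ (p ∘ toℕ) Fin.zero _ ⟩
  b2n (p 0) + length (filterᵇ (p ∘ toℕ) (tabulate (Fin.suc {n})))
    ≡⟨ cong (λ xs → b2n (p 0) + length (filterᵇ (p ∘ toℕ) xs)) (map-tabulate (id {A = Fin n}) Fin.suc) ⟨
  b2n (p 0) + length (filterᵇ (p ∘ toℕ) (map Fin.suc (allFin n)))
    ≡⟨ cong (b2n (p 0) +_) (length-filterᵇ-map (p ∘ toℕ) Fin.suc (allFin n)) ⟩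
  b2n (p 0) + length (vertices n (p ∘ suc))
    ≡⟨ cong (b2n (p 0) +_) (length-vertices n (p ∘ suc)) ⟩
  count p (suc n)
    ∎
  where open ≡-Reasoning

product3-vertices⊆triples : ∀ n {p q r : ℕ → Bool} →
  (∀ {x y} → T (p x) → T (q y) → x < y) → (∀ {y z} → T (q y) → T (r z) → y < z) →
  product3 (vertices n p) (vertices n q) (vertices n r) ⊆ triples n
product3-vertices⊆triples n {p} {q} {r} p<q q<r =
  concatMap-⊆ (filter-⊆ _ (allFin n)) (All.map (λ pi →
    concatMap-⊆ (filter-⊆ _ (allFin n)) (All.map (λ qj → map⁺ _ (r-after pi qj))
      (AllP.all-filter (T? ∘ q ∘ toℕ) (allFin n))))
  (AllP.all-filter (T? ∘ p ∘ toℕ) (allFin n)))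
  where
  r-after : ∀ {i j} → T (p (toℕ i)) → T (q (toℕ j)) →
    vertices n r ⊆ filterᵇ (λ k → ltᵇ i j ∧ ltᵇ j k) (allFin n)
  r-after {i} {j} pi qj =
    filter⁺ (T? ∘ r ∘ toℕ) (λ k → T? (ltᵇ i j ∧ ltᵇ j k)) {as = allFin n}
      (λ { refl rk → Equivalence.from T-∧ (<⇒<ᵇ (p<q pi qj) , <⇒<ᵇ (q<r qj rk)) }) ⊆-refl

f-lower : ∀ L → (∀ {s} → s ≤ 2 → T (not (memℕᵇ s L))) → ∀ m n → m * 3 ≤ n → 2 ^ (m ^ 3) ≤ f n L
f-lower L allowed m n m*3≤n = begin
  2 ^ (m ^ 3)     ≡⟨ cong (2 ^_) length-S ⟨
  2 ^ length S    ≤⟨ 2^length≤length-filter-sublists (goodᵇ L) S⊆triples every-subhypergraph-good ⟩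
  f n L           ∎
  where
  open ≤-Reasoning
  As Bs Cs : List (Fin n)
  As = vertices n (interval 0 m)
  Bs = vertices n (interval m (m + m))
  Cs = vertices n (interval (m + m) (m + m + m))

  X Y Z : Fin n → Set
  X i = T (interval 0 m (toℕ i))
  Y j = T (interval m (m + m) (toℕ j))
  Z k = T (interval (m + m) (m + m + m) (toℕ k))

  S : List (Triple n)
  S = product3 As Bs Cs

  3m≤n : m + m + m ≤ n
  3m≤n = subst (_≤ n) (m*3≡m+m+m m) m*3≤n
    where
    m*3≡m+m+m : ∀ m → m * 3 ≡ m + m + m
    m*3≡m+m+m = solve-∀

  2m≤n : m + m ≤ n
  2m≤n = ≤-trans (m≤m+n (m + m) m) 3m≤n

  m≤n : m ≤ n
  m≤n = ≤-trans (m≤m+n m m) 2m≤n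

  length-part : ∀ lo → lo + m ≤ n → length (vertices n (interval lo (lo + m))) ≡ m
  length-part lo lo+m≤n = trans (length-vertices n _) (count-interval lo m n lo+m≤n)

  length-S : length S ≡ m ^ 3
  length-S = begin-equality
    length S
      ≡⟨ length-product3 As Bs Cs ⟩
    length As * (length Bs * length Cs)
      ≡⟨ cong₂ _*_ (length-part 0 m≤n) (cong₂ _*_ (length-part m 2m≤n) (length-part (m + m) 3m≤n)) ⟩
    m * (m * m)
      ≡⟨ cong (λ k → m * (m * k)) (*-identityʳ m) ⟨
    m ^ 3
      ∎

  S⊆triples : S ⊆ triples n
  S⊆triples = product3-vertices⊆triples n
    (λ {x} {y} → interval-< 0 m (m + m) x y) (λ {y} {z} → interval-< m (m + m) (m + m + m) y z)

  S-tripartite : All (Tripartite X Y Z) S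
  S-tripartite =
    all-product3 (AllP.all-filter _ (allFin n)) (AllP.all-filter _ (allFin n)) (AllP.all-filter _ (allFin n))

  every-subhypergraph-good : ∀ {U} → U ⊆ S → T (goodᵇ L U)
  every-subhypergraph-good {U} U⊆S = good-if-spanned≤2 L U allowed
    (spanned-tripartite≤2 {X = X} {Y} {Z} {U}
      (λ {x} → interval-disjoint 0 m (m + m) (toℕ x))
      (λ {x} → interval-disjoint m (m + m) (m + m + m) (toℕ x))
      (All-resp-⊆ U⊆S S-tripartite))

small-counts-allowed : ∀ {L} → L ≡ 4 ∷ [] ⊎ L ≡ 3 ∷ 4 ∷ [] → ∀ {s} → s ≤ 2 → T (not (memℕᵇ s L))
small-counts-allowed (inj₁ refl) z≤n = _
small-counts-allowed (inj₁ refl) (s≤s z≤n) = _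
small-counts-allowed (inj₁ refl) (s≤s (s≤s z≤n)) = _
small-counts-allowed (inj₂ refl) z≤n = _
small-counts-allowed (inj₂ refl) (s≤s z≤n) = _
small-counts-allowed (inj₂ refl) (s≤s (s≤s z≤n)) = _

n≤[n/3]*6 : ∀ n → 3 ≤ n → n ≤ n / 3 * 6
n≤[n/3]*6 n 3≤n = begin
  n                       ≡⟨ m≡m%n+[m/n]*n n 3 ⟩
  n % 3 + n / 3 * 3       ≤⟨ +-monoˡ-≤ (n / 3 * 3) (≤-trans (<⇒≤ (m%n<n n 3)) (*-monoˡ-≤ 3 (m≥n⇒m/n>0 3≤n))) ⟩
  n / 3 * 3 + n / 3 * 3   ≡⟨ double (n / 3) ⟩
  n / 3 * 6               ∎
  where
  open ≤-Reasoning
  double : ∀ m → m * 3 + m * 3 ≡ m * 6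
  double = solve-∀

[m*6]³≡m³*216 : ∀ m → (m * 6) ^ 3 ≡ m ^ 3 * 216
[m*6]³≡m³*216 = expanded
  where
  expanded : ∀ m → m * 6 * (m * 6 * (m * 6 * 1)) ≡ m * (m * (m * 1)) * 216
  expanded = solve-∀

claim4p5 : (L : List ℕ) → (L ≡ 4 ∷ [] ⊎ L ≡ 3 ∷ 4 ∷ []) →
    ∃[ a ] ∃[ b ] ∃[ N ] (0 < a × 0 < b ×
      ((n : ℕ) → N ≤ n → 2 ^ (n ^ 3) ≤ f n L ^ a × f n L ≤ 2 ^ (b * n ^ 3)))
claim4p5 L L≡ = 216 , 1 , 3 , z<s , z<s , λ n 3≤n → lower n 3≤n , upper n
  where
  open ≤-Reasoning
  lower : ∀ n → 3 ≤ n → 2 ^ (n ^ 3) ≤ f n L ^ 216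
  lower n 3≤n = begin
    2 ^ (n ^ 3)                ≤⟨ ^-monoʳ-≤ 2 (^-monoˡ-≤ 3 (n≤[n/3]*6 n 3≤n)) ⟩
    2 ^ ((n / 3 * 6) ^ 3)      ≡⟨ cong (2 ^_) ([m*6]³≡m³*216 (n / 3)) ⟩
    2 ^ ((n / 3) ^ 3 * 216)    ≡⟨ ^-*-assoc 2 ((n / 3) ^ 3) 216 ⟨
    (2 ^ (n / 3) ^ 3) ^ 216    ≤⟨ ^-monoˡ-≤ 216 (f-lower L (small-counts-allowed L≡) (n / 3) n (m/n*n≤m n 3)) ⟩
    f n L ^ 216                ∎
  upper : ∀ n → f n L ≤ 2 ^ (1 * n ^ 3)
  upper n = subst (λ e → f n L ≤ 2 ^ e) (sym (*-identityˡ (n ^ 3))) (f-upper n L)
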